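{- Let $r\ge 3$ and $n_1\ge \cdots \ge n_r\ge 2$. Then $\mu_{\rm t}(K_{n_1}\,\square\, \cdots\,\square\, K_{n_r})$ equals the maximum cardinality of a family of maximal cliques of the complete multipartite graph $K_{n_1,\ldots,n_r}$ such that no two cliques of the family intersect in exactly $r-2$ vertices (i.e., in an $(r-2)$-clique).
   Context: For a connected graph $G$ and $X\subseteq V(G)$, two vertices $x,y$ are $X$-visible if there is a shortest $x,y$-path none of whose internal vertices lies in $X$. $X$ is a total mutual-visibility set if every two vertices of $V(G)$ are $X$-visible. $\mu_{\rm t}(G)$ is the maximum cardinality of a total mutual-visibility set of $G$. $\square$ denotes the Cartesian product of graphs. $K_{n_1,\ldots,n_r}$ is the complete $r$-partite graph with parts of sizes $n_1,\dots,n_r$; its maximal cliques are exactly the $r$-cliques containing one vertex from each part. -}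

module Defs where

open import Level using (0ℓ)
open import Data.Nat using (ℕ; zero; suc; _≤_; _≥_; _∸_)
open import Data.Fin using (Fin)
open import Data.List using (List; []; _∷_; length; lookup)
open import Data.List.Membership.Propositional using (_∈_; _∉_)
open import Data.List.Relation.Unary.All using (All)
open import Data.List.Relation.Unary.AllPairs using (AllPairs)
open import Data.List.Relation.Unary.Unique.Propositional using (Unique)
open import Data.List.Relation.Binary.Subset.Propositional using (_⊆_)
open import Data.Product using (Σ; ∃; _×_; _,_)
open import Data.Sum using (_⊎_)
open import Relation.Binary.PropositionalEquality using (_≡_; _≢_)
open import Relation.Nullary using (¬_)
open import Function.Bundles using (_⇔_)

record Graph : Set₁ where
  field
    V   : Set
    _~_ : V → V → Set
open Graph public

K : ℕ → Graph
K n = record { V = Fin n ; _~_ = λ i j → i ≢ j }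

_□_ : Graph → Graph → Graph
G □ H = record
  { V   = V G × V H
  ; _~_ = λ { (g , h) (g' , h') →
            (_~_ G g g' × h ≡ h') ⊎ (g ≡ g' × _~_ H h h') } }

prodK : ℕ → List ℕ → Graph
prodK n []       = K n
prodK n (m ∷ ms) = K n □ prodK m ms

module _ (G : Graph) where
  private
    W = V G
    _≈_ = _~_ G

  data Walk : W → W → Set where
    []  : ∀ {x} → Walk x x
    _∷_ : ∀ {x y z} → x ≈ y → Walk y z → Walk x z

  walkLength : ∀ {x y} → Walk x y → ℕ
  walkLength []      = 0
  walkLength (_ ∷ w) = suc (walkLength w)

  internal : ∀ {x y} → Walk x y → List W
  internal []                         = []
  internal (_ ∷ [])                   = []
  internal (_∷_ {y = y} _ (e ∷ w))    = y ∷ internal (e ∷ w)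

  IsShortest : ∀ {x y} → Walk x y → Set
  IsShortest {x} {y} w = ∀ (w' : Walk x y) → walkLength w ≤ walkLength w'

  Visible : List W → W → W → Set
  Visible X x y = Σ (Walk x y) λ w → IsShortest w × All (λ v → v ∉ X) (internal w)

  TotalMutualVisibility : List W → Set
  TotalMutualVisibility X = ∀ x y → Visible X x y

  -- μ_t(G) = m  (sets of vertices represented as duplicate-free lists)
  μt≡ : ℕ → Set
  μt≡ m = (Σ (List W) λ X → Unique X × TotalMutualVisibility X × length X ≡ m)
        × (∀ X → Unique X → TotalMutualVisibility X → length X ≤ m)

  IsClique : List W → Set
  IsClique C = Unique C × AllPairs _≈_ C

  IsMaximalClique : List W → Set
  IsMaximalClique C = IsClique C × (∀ D → IsClique D → C ⊆ D → D ⊆ C)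

-- the complete multipartite graph K_{n₁,...,n_r}, ns = n₁ ∷ ... ∷ n_r;
-- vertex (i , j) is the j-th vertex of the i-th part
Kmulti : List ℕ → Graph
Kmulti ns = record
  { V   = Σ (Fin (length ns)) (λ i → Fin (lookup ns i))
  ; _~_ = λ { (i , _) (i' , _) → i ≢ i' } }

module _ {A : Set} where
  SameSet : List A → List A → Set
  SameSet C D = C ⊆ D × D ⊆ C

  IntersectionSize : List A → List A → ℕ → Set
  IntersectionSize C D k =
    Σ (List A) λ L → Unique L × (∀ v → (v ∈ L) ⇔ (v ∈ C × v ∈ D)) × length L ≡ k

GoodCliqueFamily : (ns : List ℕ) → List (List (V (Kmulti ns))) → Set
GoodCliqueFamily ns F =
  All (IsMaximalClique (Kmulti ns)) F
  × AllPairs (λ C D → ¬ SameSet C D × ¬ IntersectionSize C D (length ns ∸ 2)) F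

maxGoodFamily≡ : List ℕ → ℕ → Set
maxGoodFamily≡ ns m =
  (Σ (List (List (V (Kmulti ns)))) λ F → GoodCliqueFamily ns F × length F ≡ m)
  × (∀ F → GoodCliqueFamily ns F → length F ≤ m)

-- Vertices of K_{n₁} □ ⋯ □ K_{n_r} and maximal cliques of K_{n₁,…,n_r} are both
-- transversals (one element from each of the r parts), and two transversals at Hamming
-- distance d give cliques meeting in r − d vertices. So the clique families in question
-- are vertex sets with no two vertices at distance 2, and it remains to see that these
-- are exactly the total mutual-visibility sets. If a, b ∈ X are at distance 2, there
-- are neighbours u, v of a at distance 2 whose only common neighbours are a and b, so
-- every shortest u,v-path has an internal vertex in X. Conversely, a vertex x at
-- distance ≥ 2 from z has two neighbours closer to z which are at distance 2 from each
-- other; at most one of them lies in X, so a shortest x,z-path avoiding X can be grown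
-- greedily.

module Submission where

open import Defs
open import Data.Bool using (true; false)
open import Data.Empty using (⊥-elim)
open import Data.Fin using (Fin; zero; suc)
open import Data.Fin.Properties using (_≟_)
open import Data.List using (List; []; _∷_; _++_; length; lookup; map; filter; allFin; tabulate; cartesianProduct)
open import Data.List.Extrema.Nat using (argmax; argmax-all; f[xs]≤f[argmax])
open import Data.List.Membership.Propositional using (_∈_; _∉_; find; lose)
open import Data.List.Membership.Propositional.Properties
  using (∈-++⁺ˡ; ∈-++⁺ʳ; ∈-map⁺; ∈-map⁻; ∈-filter⁺; ∈-filter⁻; ∈-allFin; ∈-cartesianProduct⁺)
open import Data.List.Properties using (length-map; length-removeAt′; map-cong; map-tabulate)
open import Data.List.Relation.Binary.Subset.Propositional using (_⊆_)
open import Data.List.Relation.Unary.All using (All; []; _∷_)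
import Data.List.Relation.Unary.All as All
import Data.List.Relation.Unary.All.Properties as All
open import Data.List.Relation.Unary.AllPairs using (AllPairs; []; _∷_)
import Data.List.Relation.Unary.AllPairs as AllPairs
import Data.List.Relation.Unary.AllPairs.Properties as AllPairs
open import Data.List.Relation.Unary.Any using (here; there; any?; _─_; index)
open import Data.List.Relation.Unary.Linked using (Linked)
open import Data.List.Relation.Unary.Unique.Propositional using (Unique)
import Data.List.Relation.Unary.Unique.Propositional.Properties as Unique
open import Data.Nat using (ℕ; zero; suc; _+_; _∸_; _≤_; _<_; _≥_; z≤n; s≤s)
import Data.Nat as ℕ
open import Data.Nat.Properties
  using (suc-injective; ≤-trans; ≤-reflexive; ≤-antisym; n≤1+n; +-suc; +-assoc; +-comm; m≤n+m;
         +-monoˡ-≤; +-monoʳ-≤; m+n≡0⇒m≡0; m+n≡0⇒n≡0; m+n∸m≡n; m+[n∸m]≡n; +-cancelʳ-≡; module ≤-Reasoning)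
open import Data.Product using (Σ; _×_; _,_; proj₁; proj₂)
open import Data.Sum using (_⊎_; inj₁; inj₂)
open import Function using (_∘_; _∘′_; id)
open import Function.Bundles using (_⇔_; mk⇔; Equivalence)
open import Relation.Binary.Definitions using (DecidableEquality)
open import Relation.Binary.PropositionalEquality
open import Relation.Nullary using (¬_; yes; no; does; ¬?; _×-dec_)
open import Relation.Nullary.Decidable using (map′)
open import Relation.Unary using (Decidable)

module _ {A : Set} where

  ∈-─ : ∀ {x z : A} {ys} (x∈ys : x ∈ ys) → z ∈ ys → z ≢ x → z ∈ (ys ─ x∈ys)
  ∈-─ (here refl) (here refl) z≢x = ⊥-elim (z≢x refl)
  ∈-─ (here refl) (there z∈ys) _  = z∈ys
  ∈-─ (there _)   (here refl) _   = here refl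
  ∈-─ (there x∈ys) (there z∈ys) z≢x = there (∈-─ x∈ys z∈ys z≢x)

  Unique-⊆⇒length≤ : ∀ {xs ys : List A} → Unique xs → xs ⊆ ys → length xs ≤ length ys
  Unique-⊆⇒length≤ {[]}     _                  _     = z≤n
  Unique-⊆⇒length≤ {x ∷ xs} {ys} (x∉xs ∷ unique) xs⊆ys = begin
    suc (length xs)          ≤⟨ s≤s (Unique-⊆⇒length≤ unique xs⊆ys─x) ⟩
    suc (length (ys ─ x∈ys)) ≡⟨ sym (length-removeAt′ ys (index x∈ys)) ⟩
    length ys                ∎
    where
    open ≤-Reasoning
    x∈ys : x ∈ ys
    x∈ys = xs⊆ys (here refl)
    xs⊆ys─x : xs ⊆ (ys ─ x∈ys)
    xs⊆ys─x z∈xs = ∈-─ x∈ys (xs⊆ys (there z∈xs)) (λ z≡x → All.lookup x∉xs z∈xs (sym z≡x))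

  sublists : List A → List (List A)
  sublists []       = [] ∷ []
  sublists (x ∷ xs) = sublists xs ++ map (x ∷_) (sublists xs)

  filter∈sublists : ∀ {P : A → Set} (P? : Decidable P) xs → filter P? xs ∈ sublists xs
  filter∈sublists P? []       = here refl
  filter∈sublists P? (x ∷ xs) with does (P? x)
  ... | true  = ∈-++⁺ʳ (sublists xs) (∈-map⁺ (x ∷_) (filter∈sublists P? xs))
  ... | false = ∈-++⁺ˡ (filter∈sublists P? xs)

  IsMaximumSize : (List A → Set) → ℕ → Set
  IsMaximumSize Q m = (Σ (List A) λ X → Unique X × Q X × length X ≡ m)
                    × (∀ X → Unique X → Q X → length X ≤ m)

  IsMaximumSize-⇔ : ∀ {Q Q' m} → (∀ X → Q X → Q' X) → (∀ X → Q' X → Q X) →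
    IsMaximumSize Q m → IsMaximumSize Q' m
  IsMaximumSize-⇔ Q⇒Q' Q'⇒Q ((X , unique , QX , length≡) , bound) =
    (X , unique , Q⇒Q' X QX , length≡) , λ Y uniqueY Q'Y → bound Y uniqueY (Q'⇒Q Y Q'Y)

  module _ (_≟_ : DecidableEquality A) {Q : List A → Set} (Q? : Decidable Q) (Q[] : Q [])
           (Q-⊆ : ∀ {X Y} → X ⊆ Y → Q Y → Q X) where
    open import Data.List.Membership.DecPropositional _≟_ using (_∈?_)
    open import Data.List.Relation.Unary.Unique.DecPropositional _≟_ using (unique?)

    maximumSize : (U : List A) → Unique U → (∀ x → x ∈ U) → Σ ℕ (IsMaximumSize Q)
    maximumSize U uniqueU complete = length best , (best , proj₁ R-best , proj₂ R-best , refl) , bound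
      where
      R : List A → Set
      R S = Unique S × Q S
      R? : Decidable R
      R? S = unique? S ×-dec Q? S
      candidates : List (List A)
      candidates = filter R? (sublists U)
      best : List A
      best = argmax length [] candidates
      R-best : R best
      R-best = argmax-all length ([] , Q[]) (All.all-filter R? (sublists U))
      -- The elements of U lying in X form a candidate at least as long as X.
      bound : ∀ X → Unique X → Q X → length X ≤ length best
      bound X uniqueX QX = ≤-trans (Unique-⊆⇒length≤ uniqueX X⊆S)
        (All.lookup (f[xs]≤f[argmax] {f = length} [] candidates) S∈candidates)
        where
        S : List A
        S = filter (_∈? X) U
        X⊆S : X ⊆ S
        X⊆S {x} x∈X = ∈-filter⁺ (_∈? X) (complete x) x∈X
        S⊆X : S ⊆ X
        S⊆X x∈S = proj₂ (∈-filter⁻ (_∈? X) {xs = U} x∈S)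
        S∈candidates : S ∈ candidates
        S∈candidates = ∈-filter⁺ R? (filter∈sublists (_∈? X) U) (Unique.filter⁺ (_∈? X) uniqueU , Q-⊆ S⊆X QX)

module _ {A : Set} where

  AllPairs-∈ : ∀ {R : A → A → Set} {xs x y} → AllPairs R xs → x ∈ xs → y ∈ xs →
    x ≡ y ⊎ R x y ⊎ R y x
  AllPairs-∈ (_ ∷ _)    (here refl) (here refl) = inj₁ refl
  AllPairs-∈ (Rx ∷ _)   (here refl) (there y∈) = inj₂ (inj₁ (All.lookup Rx y∈))
  AllPairs-∈ (Rx ∷ _)   (there x∈) (here refl) = inj₂ (inj₂ (All.lookup Rx x∈))
  AllPairs-∈ (_ ∷ pairs) (there x∈) (there y∈) = AllPairs-∈ pairs x∈ y∈

  intersectionSize-unique : ∀ {C D : List A} {k k'} →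
    IntersectionSize C D k → IntersectionSize C D k' → k ≡ k'
  intersectionSize-unique {C} {D} (L , uniqueL , L⇔ , refl) (L' , uniqueL' , L'⇔ , refl) =
    ≤-antisym (Unique-⊆⇒length≤ uniqueL (transfer L⇔ L'⇔)) (Unique-⊆⇒length≤ uniqueL' (transfer L'⇔ L⇔))
    where
    transfer : ∀ {L L'} → (∀ v → (v ∈ L) ⇔ (v ∈ C × v ∈ D)) → (∀ v → (v ∈ L') ⇔ (v ∈ C × v ∈ D)) →
      L ⊆ L'
    transfer L⇔ L'⇔ {v} v∈L = Equivalence.from (L'⇔ v) (Equivalence.to (L⇔ v) v∈L)

  intersectionSize-resp-SameSet : ∀ {C C' D D' : List A} {k} → SameSet C C' → SameSet D D' →
    IntersectionSize C D k → IntersectionSize C' D' k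
  intersectionSize-resp-SameSet {C' = C'} {D' = D'} (C⊆C' , C'⊆C) (D⊆D' , D'⊆D) (L , uniqueL , L⇔ , length≡) =
    L , uniqueL , L⇔' , length≡
    where
    L⇔' : ∀ v → (v ∈ L) ⇔ (v ∈ C' × v ∈ D')
    L⇔' v = mk⇔ (λ v∈L → let v∈C , v∈D = Equivalence.to (L⇔ v) v∈L in C⊆C' v∈C , D⊆D' v∈D)
                (λ (v∈C' , v∈D') → Equivalence.from (L⇔ v) (C'⊆C v∈C' , D'⊆D v∈D'))

module _ {A : Set} {R : A → A → Set} where

  Unique⇒AllPairs : ∀ {xs} → (∀ {x y} → x ∈ xs → y ∈ xs → x ≢ y → R x y) →
    Unique xs → AllPairs R xs
  Unique⇒AllPairs _ []             = []
  Unique⇒AllPairs R-∈ (x≢ ∷ unique) =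
    All.tabulate (λ y∈ → R-∈ (here refl) (there y∈) (All.lookup x≢ y∈)) ∷
    Unique⇒AllPairs (λ x∈ y∈ → R-∈ (there x∈) (there y∈)) unique

module _ {A B : Set} {Rep : A → B → Set} where

  pick : ∀ {xs} → All (λ x → Σ B (Rep x)) xs → List B
  pick []              = []
  pick ((b , _) ∷ reps) = b ∷ pick reps

  length-pick : ∀ {xs} (reps : All (λ x → Σ B (Rep x)) xs) → length (pick reps) ≡ length xs
  length-pick []       = refl
  length-pick (_ ∷ reps) = cong suc (length-pick reps)

  AllPairs-pick : ∀ {R : A → A → Set} {S : B → B → Set} →
    (∀ {x y a b} → Rep x a → Rep y b → R x y → S a b) →
    ∀ {xs} (reps : All (λ x → Σ B (Rep x)) xs) → AllPairs R xs → AllPairs S (pick reps)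
  AllPairs-pick R⇒S [] [] = []
  AllPairs-pick {R} {S} R⇒S ((a , rep) ∷ reps) (Rx ∷ pairs) = allS reps Rx ∷ AllPairs-pick R⇒S reps pairs
    where
    allS : ∀ {ys} (reps' : All (λ x → Σ B (Rep x)) ys) → All (R _) ys → All (S a) (pick reps')
    allS []                 []         = []
    allS ((b , rep') ∷ reps') (Rxy ∷ Rxs) = R⇒S rep rep' Rxy ∷ allS reps' Rxs

length-filter-map : ∀ {A B : Set} {P : B → Set} (P? : Decidable P) (f : A → B) xs →
  length (filter P? (map f xs)) ≡ length (filter (P? ∘ f) xs)
length-filter-map P? f []       = refl
length-filter-map P? f (x ∷ xs) with does (P? (f x))
... | true  = cong suc (length-filter-map P? f xs)
... | false = length-filter-map P? f xs

-- Hamming distance on products of complete graphs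

δ : ∀ {n} → Fin n → Fin n → ℕ
δ a b with a ≟ b
... | yes _ = 0
... | no  _ = 1

δ-refl : ∀ {n} (a : Fin n) → δ a a ≡ 0
δ-refl a with a ≟ a
... | yes _   = refl
... | no  a≢a = ⊥-elim (a≢a refl)

δ-≢ : ∀ {n} {a b : Fin n} → a ≢ b → δ a b ≡ 1
δ-≢ {a = a} {b} a≢b with a ≟ b
... | yes a≡b = ⊥-elim (a≢b a≡b)
... | no  _   = refl

δ≤1 : ∀ {n} (a b : Fin n) → δ a b ≤ 1
δ≤1 a b with a ≟ b
... | yes _ = z≤n
... | no  _ = s≤s z≤n

δ-sym : ∀ {n} (a b : Fin n) → δ a b ≡ δ b a
δ-sym a b with a ≟ b | b ≟ a
... | yes _   | yes _   = refl
... | yes a≡b | no  b≢a = ⊥-elim (b≢a (sym a≡b))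
... | no  a≢b | yes b≡a = ⊥-elim (a≢b (sym b≡a))
... | no  _   | no  _   = refl

δ≡0⇒≡ : ∀ {n} {a b : Fin n} → δ a b ≡ 0 → a ≡ b
δ≡0⇒≡ {a = a} {b} δ≡0 with a ≟ b
... | yes a≡b = a≡b

δ≡1⇒≢ : ∀ {n} {a b : Fin n} → δ a b ≡ 1 → a ≢ b
δ≡1⇒≢ {a = a} {b} δ≡1 with a ≟ b
... | no a≢b = a≢b

record HammingMetric (G : Graph) : Set where
  field
    dist      : V G → V G → ℕ
    dist-refl : ∀ x → dist x x ≡ 0
    dist-sym  : ∀ x y → dist x y ≡ dist y x
    dist≡0⇒≡  : ∀ {x y} → dist x y ≡ 0 → x ≡ y
    ~⇒dist≡1  : ∀ {x y} → _~_ G x y → dist x y ≡ 1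
    dist≡1⇒~  : ∀ {x y} → dist x y ≡ 1 → _~_ G x y
    dist-~-≤  : ∀ {x y} z → _~_ G x y → dist x z ≤ suc (dist y z)
    twoCloserNeighbours : ∀ {k} x z → dist x z ≡ suc (suc k) →
      Σ (V G) λ y → Σ (V G) λ y' → _~_ G x y × _~_ G x y' ×
        dist y z ≡ suc k × dist y' z ≡ suc k × dist y y' ≡ 2
    square : ∀ a b → dist a b ≡ 2 →
      Σ (V G) λ u → Σ (V G) λ v → _~_ G u a × _~_ G a v × dist u v ≡ 2 ×
        (∀ y → _~_ G u y → _~_ G y v → y ≡ a ⊎ y ≡ b)

K-hammingMetric : ∀ n → HammingMetric (K n)
K-hammingMetric n = record
  { dist      = δ
  ; dist-refl = δ-refl
  ; dist-sym  = δ-sym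
  ; dist≡0⇒≡  = δ≡0⇒≡
  ; ~⇒dist≡1  = δ-≢
  ; dist≡1⇒~  = δ≡1⇒≢
  ; dist-~-≤  = λ {a} z _ → ≤-trans (δ≤1 a z) (s≤s z≤n)
  ; twoCloserNeighbours = λ a b δ≡2+k → tooFar (≤-trans (≤-reflexive (sym δ≡2+k)) (δ≤1 a b))
  ; square = λ a b δ≡2 → tooFar (≤-trans (≤-reflexive (sym δ≡2)) (δ≤1 a b))
  }
  where
  tooFar : ∀ {k} {A : Set} → suc (suc k) ≤ 1 → A
  tooFar (s≤s ())

module _ {n : ℕ} {H : Graph} (M : HammingMetric H) where
  open HammingMetric M

  private
    G : Graph
    G = K n □ H
    _≈_ : V G → V G → Set
    _≈_ = _~_ G
    _≈H_ : V H → V H → Set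
    _≈H_ = _~_ H

    d : V G → V G → ℕ
    d (a , v) (b , w) = δ a b + dist v w

    d-sameFirst : ∀ a v w → d (a , v) (a , w) ≡ dist v w
    d-sameFirst a v w = cong (_+ dist v w) (δ-refl a)

    d-≡0⇒≡ : ∀ {x y} → d x y ≡ 0 → x ≡ y
    d-≡0⇒≡ {a , v} {b , w} d≡0 =
      cong₂ _,_ (δ≡0⇒≡ (m+n≡0⇒m≡0 (δ a b) d≡0)) (dist≡0⇒≡ (m+n≡0⇒n≡0 (δ a b) d≡0))

    ≈⇒d≡1 : ∀ {x y} → x ≈ y → d x y ≡ 1
    ≈⇒d≡1 {a , v} (inj₁ (a≢b , refl)) = cong₂ _+_ (δ-≢ a≢b) (dist-refl v)
    ≈⇒d≡1 {a , v} (inj₂ (refl , v~w)) = cong₂ _+_ (δ-refl a) (~⇒dist≡1 v~w)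

    d≡1⇒≈ : ∀ {x y} → d x y ≡ 1 → x ≈ y
    d≡1⇒≈ {a , v} {b , w} d≡1 with a ≟ b
    ... | yes refl = inj₂ (refl , dist≡1⇒~ d≡1)
    ... | no  a≢b  = inj₁ (a≢b , dist≡0⇒≡ (suc-injective d≡1))

    d-≈-≤ : ∀ {x y} z → x ≈ y → d x z ≤ suc (d y z)
    d-≈-≤ {a , v} (c , w) (inj₁ (_ , refl)) =
      ≤-trans (+-monoˡ-≤ (dist v w) (δ≤1 a c)) (s≤s (m≤n+m _ _))
    d-≈-≤ {a , v} {_ , v'} (c , w) (inj₂ (refl , v~v')) =
      ≤-trans (+-monoʳ-≤ (δ a c) (dist-~-≤ w v~v')) (≤-reflexive (+-suc (δ a c) _))

    closerNeighbour : ∀ {k} x z → dist x z ≡ suc k → Σ (V H) λ y → x ≈H y × dist y z ≡ k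
    closerNeighbour {zero} x z dist≡1 = z , dist≡1⇒~ dist≡1 , dist-refl z
    closerNeighbour {suc k} x z dist≡2+k with twoCloserNeighbours x z dist≡2+k
    ... | y , _ , x~y , _ , dist≡1+k , _ = y , x~y , dist≡1+k

    d-twoCloserNeighbours : ∀ {k} x z → d x z ≡ suc (suc k) →
      Σ (V G) λ y → Σ (V G) λ y' → x ≈ y × x ≈ y' × d y z ≡ suc k × d y' z ≡ suc k × d y y' ≡ 2
    d-twoCloserNeighbours (a , v) (b , w) d≡2+k with a ≟ b
    ... | yes refl with twoCloserNeighbours v w d≡2+k
    ... | y , y' , v~y , v~y' , e , e' , e'' =
      (a , y) , (a , y') , inj₂ (refl , v~y) , inj₂ (refl , v~y') ,
      trans (d-sameFirst a y w) e , trans (d-sameFirst a y' w) e' , trans (d-sameFirst a y y') e''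
    d-twoCloserNeighbours (a , v) (b , w) d≡2+k | no a≢b with closerNeighbour v w (suc-injective d≡2+k)
    ... | y , v~y , e =
      (b , v) , (a , y) , inj₁ (a≢b , refl) , inj₂ (refl , v~y) ,
      trans (d-sameFirst b v w) (suc-injective d≡2+k) ,
      cong₂ _+_ (δ-≢ a≢b) e , cong₂ _+_ (δ-≢ (a≢b ∘′ sym)) (~⇒dist≡1 v~y)

    d-square : ∀ x z → d x z ≡ 2 →
      Σ (V G) λ u → Σ (V G) λ u' → u ≈ x × x ≈ u' × d u u' ≡ 2 ×
        (∀ y → u ≈ y → y ≈ u' → y ≡ x ⊎ y ≡ z)
    d-square (a , v) (b , w) d≡2 with a ≟ b
    ... | yes refl with square v w d≡2
    ... | u , u' , u~v , v~u' , dist≡2 , onlyVW =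
      (a , u) , (a , u') , inj₂ (refl , u~v) , inj₂ (refl , v~u') , trans (d-sameFirst a u u') dist≡2 , only
      where
      only : ∀ y → (a , u) ≈ y → y ≈ (a , u') → y ≡ (a , v) ⊎ y ≡ (a , w)
      only _       (inj₁ (_ , refl)) (inj₁ (_ , refl))   with () ← trans (sym (dist-refl u)) dist≡2
      only _       (inj₁ (a≢c , _))  (inj₂ (c≡a , _))    = ⊥-elim (a≢c (sym c≡a))
      only _       (inj₂ (refl , _)) (inj₁ (a≢a , _))    = ⊥-elim (a≢a refl)
      only (_ , y) (inj₂ (refl , u~y)) (inj₂ (_ , y~u')) with onlyVW y u~y y~u'
      ... | inj₁ refl = inj₁ refl
      ... | inj₂ refl = inj₂ refl
    -- u and u' are the other two corners of the 4-cycle through (a , v) and (b , w).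
    d-square (a , v) (b , w) d≡2 | no a≢b =
      (a , w) , (b , v) , inj₂ (refl , dist≡1⇒~ (trans (dist-sym w v) dist≡1)) , inj₁ (a≢b , refl) ,
      cong₂ _+_ (δ-≢ a≢b) (trans (dist-sym w v) dist≡1) , only
      where
      dist≡1 : dist v w ≡ 1
      dist≡1 = suc-injective d≡2
      only : ∀ y → (a , w) ≈ y → y ≈ (b , v) → y ≡ (a , v) ⊎ y ≡ (b , w)
      only _ (inj₁ (_ , refl)) (inj₁ (_ , refl))  with () ← trans (sym (dist-refl v)) dist≡1
      only _ (inj₁ (_ , refl)) (inj₂ (refl , _))  = inj₂ refl
      only _ (inj₂ (refl , _)) (inj₁ (_ , refl))  = inj₁ refl
      only _ (inj₂ (refl , _)) (inj₂ (a≡b , _))   = ⊥-elim (a≢b a≡b)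

  □-hammingMetric : HammingMetric (K n □ H)
  □-hammingMetric = record
    { dist      = d
    ; dist-refl = λ (a , v) → cong₂ _+_ (δ-refl a) (dist-refl v)
    ; dist-sym  = λ (a , v) (b , w) → cong₂ _+_ (δ-sym a b) (dist-sym v w)
    ; dist≡0⇒≡  = d-≡0⇒≡
    ; ~⇒dist≡1  = ≈⇒d≡1
    ; dist≡1⇒~  = d≡1⇒≈
    ; dist-~-≤  = d-≈-≤
    ; twoCloserNeighbours = d-twoCloserNeighbours
    ; square = d-square
    }

prodK-hammingMetric : ∀ n ns → HammingMetric (prodK n ns)
prodK-hammingMetric n []       = K-hammingMetric n
prodK-hammingMetric n (m ∷ ms) = □-hammingMetric (prodK-hammingMetric m ms)

-- Total mutual visibility in Hamming graphs

module _ (G : Graph) where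

  walkLength≡2 : ∀ {x z} (w : Walk G x z) → walkLength G w ≡ 2 →
    Σ (V G) λ y → _~_ G x y × _~_ G y z × internal G w ≡ y ∷ []
  walkLength≡2 (x~y ∷ y~z ∷ []) refl = _ , x~y , y~z , refl

  AvoidingWalk : List (V G) → ℕ → V G → V G → Set
  AvoidingWalk X k x z = Σ (Walk G x z) λ w → walkLength G w ≡ k × All (_∉ X) (internal G w)

  ∷-avoidingWalk : ∀ {X k x y z} → _~_ G x y → y ∉ X →
    AvoidingWalk X (suc k) y z → AvoidingWalk X (suc (suc k)) x z
  ∷-avoidingWalk x~y y∉X (_ ∷ w , length≡ , avoids) = x~y ∷ _ ∷ w , cong suc length≡ , y∉X ∷ avoids

module _ {G : Graph} (M : HammingMetric G) where
  open HammingMetric M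

  ≡-dec : DecidableEquality (V G)
  ≡-dec x y = map′ dist≡0⇒≡ (λ { refl → dist-refl x }) (dist x y ℕ.≟ 0)

  open import Data.List.Membership.DecPropositional ≡-dec using (_∈?_)

  dist≤walkLength : ∀ {x z} (w : Walk G x z) → dist x z ≤ walkLength G w
  dist≤walkLength {x} []         = ≤-reflexive (dist-refl x)
  dist≤walkLength {z = z} (x~y ∷ w) = ≤-trans (dist-~-≤ z x~y) (s≤s (dist≤walkLength w))

  Distance2Free : List (V G) → Set
  Distance2Free X = ∀ {a b} → a ∈ X → b ∈ X → dist a b ≢ 2

  distance2Free? : Decidable Distance2Free
  distance2Free? X = map′ (λ free a∈X b∈X → All.lookup (All.lookup free a∈X) b∈X)
                          (λ free → All.tabulate λ a∈X → All.tabulate λ b∈X → free a∈X b∈X)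
                          (All.all? (λ a → All.all? (λ b → ¬? (dist a b ℕ.≟ 2)) X) X)

  distance2Free-anti-mono : ∀ {X Y} → X ⊆ Y → Distance2Free Y → Distance2Free X
  distance2Free-anti-mono X⊆Y free a∈X b∈X = free (X⊆Y a∈X) (X⊆Y b∈X)

  totalMutualVisibility⇒distance2Free : ∀ X → TotalMutualVisibility G X → Distance2Free X
  totalMutualVisibility⇒distance2Free X visible {a} {b} a∈X b∈X dist≡2
    with u , u' , u~a , a~u' , dist≡2' , onlyAB ← square a b dist≡2
    with w , shortest , avoids ← visible u u'
    with y , u~y , y~u' , internal≡y ← walkLength≡2 G w
           (≤-antisym (shortest (u~a ∷ a~u' ∷ [])) (subst (_≤ walkLength G w) dist≡2' (dist≤walkLength w)))
    with subst (All (_∉ X)) internal≡y avoids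
  ... | y∉X ∷ [] with onlyAB y u~y y~u'
  ... | inj₁ refl = y∉X a∈X
  ... | inj₂ refl = y∉X b∈X

  module _ {X : List (V G)} (free : Distance2Free X) where

    avoidingWalk-step : ∀ {k z} → (∀ y → dist y z ≡ suc k → AvoidingWalk G X (suc k) y z) →
      ∀ x → dist x z ≡ suc (suc k) → AvoidingWalk G X (suc (suc k)) x z
    avoidingWalk-step {z = z} avoidingWalk x dist≡2+k
      with y , y' , x~y , x~y' , dist-y , dist-y' , dist-yy' ← twoCloserNeighbours x z dist≡2+k
      with y ∈? X | y' ∈? X
    ... | yes y∈X | yes y'∈X = ⊥-elim (free y∈X y'∈X dist-yy')
    ... | no  y∉X | _        = ∷-avoidingWalk G x~y y∉X (avoidingWalk y dist-y)
    ... | yes _   | no y'∉X  = ∷-avoidingWalk G x~y' y'∉X (avoidingWalk y' dist-y')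

    distance2Free⇒avoidingWalk : ∀ k x z → dist x z ≡ k → AvoidingWalk G X k x z
    distance2Free⇒avoidingWalk zero x z dist≡0 with refl ← dist≡0⇒≡ dist≡0 = [] , refl , []
    distance2Free⇒avoidingWalk (suc zero) x z dist≡1 = dist≡1⇒~ dist≡1 ∷ [] , refl , []
    distance2Free⇒avoidingWalk (suc (suc k)) x z =
      avoidingWalk-step (λ y → distance2Free⇒avoidingWalk (suc k) y z) x

  distance2Free⇒totalMutualVisibility : ∀ X → Distance2Free X → TotalMutualVisibility G X
  distance2Free⇒totalMutualVisibility X free x z
    with w , length≡ , avoids ← distance2Free⇒avoidingWalk free (dist x z) x z refl =
    w , (λ w' → subst (_≤ walkLength G w') (sym length≡) (dist≤walkLength w')) , avoids

-- Maximal cliques of complete multipartite graphs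

Transversal : List ℕ → Set
Transversal ns = (i : Fin (length ns)) → Fin (lookup ns i)

agreements : ∀ {r} {h : Fin r → ℕ} (f g : (i : Fin r) → Fin (h i)) → List (Fin r)
agreements f g = filter (λ i → f i ≟ g i) (allFin _)

module MultipartiteCliques (ns : List ℕ) where

  private
    G : Graph
    G = Kmulti ns

  cliqueOf : Transversal ns → List (V G)
  cliqueOf f = map (λ i → i , f i) (allFin (length ns))

  ∈-cliqueOf⁺ : ∀ f i → (i , f i) ∈ cliqueOf f
  ∈-cliqueOf⁺ f i = ∈-map⁺ _ (∈-allFin i)

  ∈-cliqueOf⁻ : ∀ f {i j} → (i , j) ∈ cliqueOf f → f i ≡ j
  ∈-cliqueOf⁻ f i,j∈ with _ , _ , refl ← ∈-map⁻ _ i,j∈ = refl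

  SameSet⇒≗ : ∀ f g → SameSet (cliqueOf f) (cliqueOf g) → ∀ i → f i ≡ g i
  SameSet⇒≗ f g (f⊆g , _) i = sym (∈-cliqueOf⁻ g (f⊆g (∈-cliqueOf⁺ f i)))

  onePerPart : ∀ {D} → AllPairs (_~_ G) D → ∀ {i j j'} → (i , j) ∈ D → (i , j') ∈ D → j ≡ j'
  onePerPart pairs i,j∈ i,j'∈ with AllPairs-∈ pairs i,j∈ i,j'∈
  ... | inj₁ refl        = refl
  ... | inj₂ (inj₁ i≢i) = ⊥-elim (i≢i refl)
  ... | inj₂ (inj₂ i≢i) = ⊥-elim (i≢i refl)

  cliqueOf-isMaximalClique : ∀ f → IsMaximalClique G (cliqueOf f)
  cliqueOf-isMaximalClique f = (AllPairs.map (λ i≢i' → i≢i' ∘ cong proj₁) pairs , pairs) , maximal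
    where
    pairs : AllPairs (_~_ G) (cliqueOf f)
    pairs = AllPairs.map⁺ (Unique.allFin⁺ (length ns))
    maximal : ∀ D → IsClique G D → cliqueOf f ⊆ D → D ⊆ cliqueOf f
    maximal D (_ , pairsD) f⊆D {i , j} i,j∈D =
      subst (λ j → (i , j) ∈ cliqueOf f)
            (onePerPart pairsD (f⊆D (∈-cliqueOf⁺ f i)) i,j∈D) (∈-cliqueOf⁺ f i)

  maximalClique-meetsPart : Transversal ns → ∀ {C} → IsMaximalClique G C →
    ∀ i → Σ (Fin (lookup ns i)) λ j → (i , j) ∈ C
  maximalClique-meetsPart g {C} ((uniqueC , pairsC) , maximal) i with any? (λ x → proj₁ x ≟ i) C
  ... | yes inPart with (_ , j) , i,j∈C , refl ← find inPart = j , i,j∈C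
  ... | no ¬inPart = ⊥-elim (¬inPart (lose (maximal ((i , g i) ∷ C) extended there (here refl)) refl))
    where
    outside : All (λ x → i ≢ proj₁ x) C
    outside = All.map (λ ¬x∈i i≡ → ¬x∈i (sym i≡)) (All.¬Any⇒All¬ C ¬inPart)
    extended : IsClique G ((i , g i) ∷ C)
    extended = (All.map (λ i≢ eq → i≢ (cong proj₁ eq)) outside ∷ uniqueC) , (outside ∷ pairsC)

  maximalClique⇒cliqueOf : Transversal ns → ∀ {C} → IsMaximalClique G C →
    Σ (Transversal ns) λ f → SameSet C (cliqueOf f)
  maximalClique⇒cliqueOf g {C} maximalC = f , C⊆ , ⊆C
    where
    meets : ∀ i → Σ (Fin (lookup ns i)) λ j → (i , j) ∈ C
    meets = maximalClique-meetsPart g maximalC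
    f : Transversal ns
    f i = proj₁ (meets i)
    C⊆ : C ⊆ cliqueOf f
    C⊆ {i , j} i,j∈C = subst (λ j → (i , j) ∈ cliqueOf f)
      (onePerPart (proj₂ (proj₁ maximalC)) (proj₂ (meets i)) i,j∈C) (∈-cliqueOf⁺ f i)
    ⊆C : cliqueOf f ⊆ C
    ⊆C {i , j} i,j∈ = subst (λ j → (i , j) ∈ C) (∈-cliqueOf⁻ f i,j∈) (proj₂ (meets i))

  intersectionSize-cliqueOf : ∀ f g → IntersectionSize (cliqueOf f) (cliqueOf g) (length (agreements f g))
  intersectionSize-cliqueOf f g =
    common , Unique.map⁺ (cong proj₁) (Unique.filter⁺ _ (Unique.allFin⁺ _)) ,
    (λ v → mk⇔ (to v) (from v)) , length-map _ (agreements f g)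
    where
    common : List (V G)
    common = map (λ i → i , f i) (agreements f g)
    to : ∀ v → v ∈ common → v ∈ cliqueOf f × v ∈ cliqueOf g
    to _ v∈ with i , i∈ , refl ← ∈-map⁻ _ v∈ =
      ∈-cliqueOf⁺ f i ,
      subst (λ j → (i , j) ∈ cliqueOf g) (sym (proj₂ (∈-filter⁻ (λ i → f i ≟ g i) {xs = allFin _} i∈)))
            (∈-cliqueOf⁺ g i)
    from : ∀ v → v ∈ cliqueOf f × v ∈ cliqueOf g → v ∈ common
    from (i , j) (v∈f , v∈g) with refl ← ∈-cliqueOf⁻ f v∈f =
      ∈-map⁺ _ (∈-filter⁺ _ (∈-allFin i) (sym (∈-cliqueOf⁻ g v∈g)))

  cliqueOf-cong : ∀ {f g} → (∀ i → f i ≡ g i) → cliqueOf f ≡ cliqueOf g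
  cliqueOf-cong f≗g = map-cong (λ i → cong (i ,_) (f≗g i)) (allFin _)

-- Vertices of Hamming graphs as transversals

vertices : ∀ n ns → List (V (prodK n ns))
vertices n []       = allFin n
vertices n (m ∷ ms) = cartesianProduct (allFin n) (vertices m ms)

vertices-unique : ∀ n ns → Unique (vertices n ns)
vertices-unique n []       = Unique.allFin⁺ n
vertices-unique n (m ∷ ms) = Unique.cartesianProduct⁺ (Unique.allFin⁺ n) (vertices-unique m ms)

∈-vertices : ∀ n ns x → x ∈ vertices n ns
∈-vertices n []       x       = ∈-allFin x
∈-vertices n (m ∷ ms) (a , v) = ∈-cartesianProduct⁺ (∈-allFin a) (∈-vertices m ms v)

maximumDistance2Free : ∀ n ns → Σ ℕ (IsMaximumSize (Distance2Free (prodK-hammingMetric n ns)))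
maximumDistance2Free n ns = maximumSize (≡-dec M) (distance2Free? M) (λ ()) (distance2Free-anti-mono M)
                                        (vertices n ns) (vertices-unique n ns) (∈-vertices n ns)
  where
  M : HammingMetric (prodK n ns)
  M = prodK-hammingMetric n ns

coords : ∀ n ns → V (prodK n ns) → Transversal (n ∷ ns)
coords n []       a       zero    = a
coords n (m ∷ ms) (a , v) zero    = a
coords n (m ∷ ms) (a , v) (suc i) = coords m ms v i

fromCoords : ∀ n ns → Transversal (n ∷ ns) → V (prodK n ns)
fromCoords n []       f = f zero
fromCoords n (m ∷ ms) f = f zero , fromCoords m ms (f ∘ suc)

coords-fromCoords : ∀ n ns f i → coords n ns (fromCoords n ns f) i ≡ f i
coords-fromCoords n []       f zero    = refl
coords-fromCoords n (m ∷ ms) f zero    = refl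
coords-fromCoords n (m ∷ ms) f (suc i) = coords-fromCoords m ms (f ∘ suc) i

coords-injective : ∀ n ns {s t} → (∀ i → coords n ns s i ≡ coords n ns t i) → s ≡ t
coords-injective n []       s≗t = s≗t zero
coords-injective n (m ∷ ms) s≗t = cong₂ _,_ (s≗t zero) (coords-injective m ms (s≗t ∘ suc))

length-agreements-tail : ∀ {r} {h : Fin (suc r) → ℕ} (f g : (i : Fin (suc r)) → Fin (h i)) →
  length (filter (λ i → f i ≟ g i) (tabulate {n = r} suc)) ≡ length (agreements (f ∘ suc) (g ∘ suc))
length-agreements-tail {r} f g =
  trans (cong (length ∘ filter (λ i → f i ≟ g i)) (sym (map-tabulate id suc)))
        (length-filter-map (λ i → f i ≟ g i) suc (allFin r))

δ+length-agreements : ∀ {r} {h : Fin (suc r) → ℕ} (f g : (i : Fin (suc r)) → Fin (h i)) →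
  δ (f zero) (g zero) + length (agreements f g) ≡ suc (length (agreements (f ∘ suc) (g ∘ suc)))
δ+length-agreements f g with f zero ≟ g zero
... | yes _ = cong suc (length-agreements-tail f g)
... | no  _ = cong suc (length-agreements-tail f g)

dist+agreements : ∀ n ns (s t : V (prodK n ns)) →
  HammingMetric.dist (prodK-hammingMetric n ns) s t + length (agreements (coords n ns s) (coords n ns t))
    ≡ length (n ∷ ns)
dist+agreements n [] a b with a ≟ b
... | yes _ = refl
... | no  _ = refl
dist+agreements n (m ∷ ms) (a , v) (b , w) = begin
  (δ a b + dist v w) + length (agreements s t)   ≡⟨ +-assoc (δ a b) _ _ ⟩
  δ a b + (dist v w + length (agreements s t))   ≡⟨ cong (δ a b +_) (+-comm (dist v w) _) ⟩
  δ a b + (length (agreements s t) + dist v w)   ≡⟨ sym (+-assoc (δ a b) _ _) ⟩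
  (δ a b + length (agreements s t)) + dist v w   ≡⟨ cong (_+ dist v w) (δ+length-agreements s t) ⟩
  suc (length (agreements s' t') + dist v w)     ≡⟨ cong suc (+-comm _ (dist v w)) ⟩
  suc (dist v w + length (agreements s' t'))     ≡⟨ cong suc (dist+agreements m ms v w) ⟩
  suc (length (m ∷ ms))                          ∎
  where
  open ≡-Reasoning
  open HammingMetric (prodK-hammingMetric m ms)
  s t : Transversal (n ∷ m ∷ ms)
  s = coords n (m ∷ ms) (a , v)
  t = coords n (m ∷ ms) (b , w)
  s' t' : Transversal (m ∷ ms)
  s' = coords m ms v
  t' = coords m ms w

-- Vertices versus maximal cliques

transversal : ∀ {ns} → All (0 <_) ns → Transversal ns
transversal (s≤s _ ∷ _)     zero    = zero
transversal (_ ∷ nonempty) (suc i) = transversal nonempty i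

module CliqueCorrespondence (n : ℕ) (ns : List ℕ) (r≥2 : 2 ≤ length (n ∷ ns)) where
  open HammingMetric (prodK-hammingMetric n ns)
  open MultipartiteCliques (n ∷ ns)

  private
    r : ℕ
    r = length (n ∷ ns)
    Vertex Clique : Set
    Vertex = V (prodK n ns)
    Clique = List (V (Kmulti (n ∷ ns)))

  clique : Vertex → Clique
  clique s = cliqueOf (coords n ns s)

  dist≡2⇒intersectionSize : ∀ s t → dist s t ≡ 2 → IntersectionSize (clique s) (clique t) (r ∸ 2)
  dist≡2⇒intersectionSize s t dist≡2 =
    subst (IntersectionSize (clique s) (clique t)) agreements≡ (intersectionSize-cliqueOf _ _)
    where
    a : ℕ
    a = length (agreements (coords n ns s) (coords n ns t))
    agreements≡ : a ≡ r ∸ 2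
    agreements≡ = begin
      a                  ≡⟨ sym (m+n∸m≡n 2 a) ⟩
      2 + a ∸ 2          ≡⟨ cong (λ d → d + a ∸ 2) (sym dist≡2) ⟩
      dist s t + a ∸ 2   ≡⟨ cong (_∸ 2) (dist+agreements n ns s t) ⟩
      r ∸ 2              ∎
      where open ≡-Reasoning

  intersectionSize⇒dist≡2 : ∀ s t → IntersectionSize (clique s) (clique t) (r ∸ 2) → dist s t ≡ 2
  intersectionSize⇒dist≡2 s t size = +-cancelʳ-≡ (r ∸ 2) (dist s t) 2 (begin
    dist s t + (r ∸ 2)   ≡⟨ cong (dist s t +_) (intersectionSize-unique size (intersectionSize-cliqueOf _ _)) ⟩
    dist s t + length (agreements (coords n ns s) (coords n ns t)) ≡⟨ dist+agreements n ns s t ⟩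
    r                    ≡⟨ sym (m+[n∸m]≡n r≥2) ⟩
    2 + (r ∸ 2)          ∎)
    where open ≡-Reasoning

  SameSet⇒≡ : ∀ s t → SameSet (clique s) (clique t) → s ≡ t
  SameSet⇒≡ s t same = coords-injective n ns (SameSet⇒≗ _ _ same)

  Compatible : Vertex → Vertex → Set
  Compatible s t = s ≢ t × dist s t ≢ 2

  CompatibleCliques : Clique → Clique → Set
  CompatibleCliques C D = ¬ SameSet C D × ¬ IntersectionSize C D (r ∸ 2)

  compatible⇒compatibleCliques : ∀ {s t} → Compatible s t → CompatibleCliques (clique s) (clique t)
  compatible⇒compatibleCliques {s} {t} (s≢t , dist≢2) =
    (λ same → s≢t (SameSet⇒≡ s t same)) , (λ size → dist≢2 (intersectionSize⇒dist≡2 s t size))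

  Represents : Clique → Vertex → Set
  Represents C s = SameSet C (clique s)

  compatibleCliques⇒compatible : ∀ {C D s t} → Represents C s → Represents D t →
    CompatibleCliques C D → Compatible s t
  compatibleCliques⇒compatible {s = s} {t} (C⊆s , s⊆C) (D⊆t , t⊆D) (¬same , ¬size) =
    (λ { refl → ¬same ((λ x∈C → t⊆D (C⊆s x∈C)) , (λ x∈D → s⊆C (D⊆t x∈D))) }) ,
    (λ dist≡2 → ¬size (intersectionSize-resp-SameSet (s⊆C , C⊆s) (t⊆D , D⊆t)
                                                      (dist≡2⇒intersectionSize s t dist≡2)))

  clique-isMaximalClique : ∀ s → IsMaximalClique (Kmulti (n ∷ ns)) (clique s)
  clique-isMaximalClique s = cliqueOf-isMaximalClique (coords n ns s)

  maximalClique⇒represents : Transversal (n ∷ ns) → ∀ {C} → IsMaximalClique (Kmulti (n ∷ ns)) C →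
    Σ Vertex (Represents C)
  maximalClique⇒represents part maximalC with f , same ← maximalClique⇒cliqueOf part maximalC =
    fromCoords n ns f , subst (SameSet _) (sym (cliqueOf-cong (coords-fromCoords n ns f))) same

  compatible⇒distance2Free : ∀ {X} → AllPairs Compatible X → Distance2Free (prodK-hammingMetric n ns) X
  compatible⇒distance2Free pairs a∈X b∈X dist≡2 with AllPairs-∈ pairs a∈X b∈X
  ... | inj₁ refl with () ← trans (sym (dist-refl _)) dist≡2
  ... | inj₂ (inj₁ (_ , dist≢2)) = dist≢2 dist≡2
  ... | inj₂ (inj₂ (_ , dist≢2)) = dist≢2 (trans (dist-sym _ _) dist≡2)

  cliques-goodCliqueFamily : ∀ X → Unique X → Distance2Free (prodK-hammingMetric n ns) X →
    GoodCliqueFamily (n ∷ ns) (map clique X)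
  cliques-goodCliqueFamily X unique free =
    All.map⁺ (All.tabulate (λ {s} _ → clique-isMaximalClique s)) ,
    AllPairs.map⁺ (Unique⇒AllPairs (λ s∈X t∈X s≢t → compatible⇒compatibleCliques (s≢t , free s∈X t∈X))
                                   unique)

  goodCliqueFamily⇒representatives : Transversal (n ∷ ns) → ∀ F → GoodCliqueFamily (n ∷ ns) F →
    Σ (List Vertex) λ X → Unique X × Distance2Free (prodK-hammingMetric n ns) X × length X ≡ length F
  goodCliqueFamily⇒representatives part F (maximal , pairs) =
    pick reps , AllPairs.map proj₁ compatible , compatible⇒distance2Free compatible , length-pick reps
    where
    reps : All (λ C → Σ Vertex (Represents C)) F
    reps = All.map (maximalClique⇒represents part) maximal
    compatible : AllPairs Compatible (pick reps)
    compatible = AllPairs-pick compatibleCliques⇒compatible reps pairs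

  maximumDistance2Free⇒maxGoodFamily≡ : Transversal (n ∷ ns) → ∀ {m} →
    IsMaximumSize (Distance2Free (prodK-hammingMetric n ns)) m → maxGoodFamily≡ (n ∷ ns) m
  maximumDistance2Free⇒maxGoodFamily≡ part {m} ((X , uniqueX , freeX , length≡m) , bound) =
    (map clique X , cliques-goodCliqueFamily X uniqueX freeX , trans (length-map clique X) length≡m) , familyBound
    where
    familyBound : ∀ F → GoodCliqueFamily (n ∷ ns) F → length F ≤ m
    familyBound F good with Y , uniqueY , freeY , length≡ ← goodCliqueFamily⇒representatives part F good =
      subst (_≤ m) length≡ (bound Y uniqueY freeY)

open CliqueCorrespondence using (maximumDistance2Free⇒maxGoodFamily≡)

proposition2p4 : (n : ℕ) (ns : List ℕ) → 3 ≤ length (n ∷ ns)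
    → Linked _≥_ (n ∷ ns) → All (2 ≤_) (n ∷ ns)
    → Σ ℕ λ m → μt≡ (prodK n ns) m × maxGoodFamily≡ (n ∷ ns) m
proposition2p4 n ns r≥3 _ parts≥2 with m , maximum ← maximumDistance2Free n ns =
  m ,
  IsMaximumSize-⇔ (distance2Free⇒totalMutualVisibility M) (totalMutualVisibility⇒distance2Free M) maximum ,
  maximumDistance2Free⇒maxGoodFamily≡ n ns (≤-trans (n≤1+n 2) r≥3) part maximum
  where
  M : HammingMetric (prodK n ns)
  M = prodK-hammingMetric n ns
  part : Transversal (n ∷ ns)
  part = transversal (All.map (≤-trans (s≤s z≤n)) parts≥2)
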